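{- Let $m$ be an $n$-variable monomial of degree $k$. Then $|N_k(m)|=2^{k(n-k)}$.
   Context: $N_k(m)$ denotes the set of $k$-dimensional linear subspaces $U$ of $\mathbb{F}_2^n$ with $\sum_{x\in U}m(x)\neq0$ (sum in $\mathbb{F}_2$). -}

module Defs where

open import Data.Nat using (ℕ; zero; suc)
open import Data.Bool using (Bool; true; false; _∧_; _∨_; not; _xor_; if_then_else_)
open import Data.Vec using (Vec; []; _∷_; zipWith; replicate; foldr)
open import Data.List using (List; [_]; _++_; map; length)
import Data.List as L
open import Data.Product using (_×_; _,_; ∃; Σ)
open import Relation.Binary.PropositionalEquality using (_≡_)
open import Data.List.Membership.Propositional using (_∈_)
open import Data.List.Relation.Unary.Unique.Propositional using (Unique)
open import Data.Fin.Subset using (Subset)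

-- Vectors of F_2^n are Vec Bool n (false = 0, true = 1), addition is xor.

-- A subset of F_2^n, represented structurally (binary decision tree) so
-- that equality of subsets is ordinary propositional equality:
-- BSet (suc n) = (members with first coordinate 0 , members with first coordinate 1).
BSet : ℕ → Set
BSet zero    = Bool
BSet (suc n) = BSet n × BSet n

_∈ᵇ_ : {n : ℕ} → Vec Bool n → BSet n → Bool
[]          ∈ᵇ b         = b
(false ∷ x) ∈ᵇ (u₀ , u₁) = x ∈ᵇ u₀
(true  ∷ x) ∈ᵇ (u₀ , u₁) = x ∈ᵇ u₁

_⊕_ : {n : ℕ} → Vec Bool n → Vec Bool n → Vec Bool n
_⊕_ = zipWith _xor_

𝟎 : {n : ℕ} → Vec Bool n
𝟎 = replicate _ false

lincomb : {n k : ℕ} → Vec Bool k → Vec (Vec Bool n) k → Vec Bool n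
lincomb []       []       = 𝟎
lincomb (c ∷ cs) (v ∷ vs) = (if c then v else 𝟎) ⊕ lincomb cs vs

LinearlyIndependent : {n k : ℕ} → Vec (Vec Bool n) k → Set
LinearlyIndependent {k = k} b = ∀ (c : Vec Bool k) → lincomb c b ≡ 𝟎 → c ≡ 𝟎

IsSpanOf : {n k : ℕ} → BSet n → Vec (Vec Bool n) k → Set
IsSpanOf {n} {k} U b =
  ∀ (x : Vec Bool n) → (x ∈ᵇ U ≡ true → ∃ λ (c : Vec Bool k) → lincomb c b ≡ x)
                     × ((∃ λ (c : Vec Bool k) → lincomb c b ≡ x) → x ∈ᵇ U ≡ true)

IsSubspaceOfDim : {n : ℕ} → BSet n → ℕ → Set
IsSubspaceOfDim {n} U k =
  Σ (Vec (Vec Bool n) k) λ b → LinearlyIndependent b × IsSpanOf U b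

allVecs : (n : ℕ) → List (Vec Bool n)
allVecs zero    = [ [] ]
allVecs (suc n) = map (false ∷_) (allVecs n) ++ map (true ∷_) (allVecs n)

sumOver : {n : ℕ} → BSet n → (Vec Bool n → Bool) → Bool
sumOver {n} U m = L.foldr _xor_ false (map (λ x → (x ∈ᵇ U) ∧ m x) (allVecs n))

N : (n k : ℕ) → (Vec Bool n → Bool) → BSet n → Set
N n k m U = IsSubspaceOfDim U k × sumOver U m ≡ true

monomial : {n : ℕ} → Subset n → Vec Bool n → Bool
monomial S x = foldr _ _∧_ true (zipWith (λ s b → not s ∨ b) S x)

HasCard : {n : ℕ} → (BSet n → Set) → ℕ → Set
HasCard {n} P c =
  ∃ λ (Ls : List (BSet n)) → Unique Ls × (∀ U → (U ∈ Ls → P U) × (P U → U ∈ Ls)) × length Ls ≡ c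

-- Write k = ∣ S ∣ and m = ∏_{i ∈ S} xᵢ.  The sum of m over a subspace U is the parity of
-- the number of points of U lying over the all-ones vector of 𝔽₂^S.  If some nonzero
-- z ∈ U has zero S-coordinates, translation by z pairs off the points of U and preserves
-- m, so the sum vanishes.  Hence for U ∈ N_k(m) the restriction x ↦ x↾S is injective on
-- U, and since dim U = k it is onto 𝔽₂^S: U is the graph {x ∣ x↾∁S = (x↾S) W} of a
-- unique k × (n − k) matrix W.  Conversely every such graph is a k-dimensional subspace
-- with exactly one point over the all-ones vector.  So N_k(m) is in bijection with the
-- 2^(k(n−k)) matrices W.
module Submission where

open import Defs
open import Data.Nat using (ℕ; _^_; _*_; _∸_)
open import Data.Fin.Subset using (Subset; ∣_∣)
open import Relation.Binary.PropositionalEquality using (_≡_)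

open import Data.Nat using (zero; suc; _+_; _≤_; z≤n; s≤s)
open import Data.Nat.Properties using (^-*-assoc; *-comm; n≮n)
open import Data.Bool using (Bool; true; false; _∧_; _xor_; if_then_else_)
import Data.Bool as Bool
open import Data.Bool.Properties
  using (xor-assoc; xor-comm; xor-same; xor-identityˡ; xor-identityʳ; ∧-conicalˡ; ∧-conicalʳ)
open import Data.Vec using (Vec; []; _∷_; zipWith)
import Data.Vec as Vec
open import Data.Vec.Properties
  using (zipWith-assoc; zipWith-comm; zipWith-identityˡ; zipWith-identityʳ; ∷-injective; map-∘; map-cong; map-id)
import Data.Vec.Properties as Vec
open import Data.Vec.Relation.Unary.All using (All; []; _∷_)
import Data.Vec.Relation.Unary.All as All
import Data.Vec.Relation.Unary.All.Properties as All
open import Data.Fin.Subset using (∁; ⊤)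
open import Data.Fin.Subset.Properties using (∣∁p∣≡n∸∣p∣)
open import Data.List using (List; [_]; _++_; map; length; cartesianProductWith)
import Data.List as List
open import Data.List.Properties using (map-++; length-map; length-++; length-++-sucʳ)
import Data.List.Properties as List
open import Data.List.Membership.Propositional using (_∈_)
open import Data.List.Membership.Propositional.Properties
  using (∈-map⁺; ∈-map⁻; ∈-++⁺ˡ; ∈-++⁺ʳ; ∈-++⁻; ∈-∃++; ∈-cartesianProductWith⁺)
import Data.List.Membership.DecPropositional as DecMembership
open import Data.List.Relation.Unary.Unique.Propositional using (Unique)
import Data.List.Relation.Unary.Unique.Propositional.Properties as Unique
open import Data.List.Relation.Unary.AllPairs using ([]; _∷_)
import Data.List.Relation.Unary.All as ListAll
open import Data.List.Relation.Unary.Any using (here; there)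
open import Data.Product using (_×_; _,_; ∃; proj₁; proj₂)
open import Data.Sum using (inj₁; inj₂)
open import Data.Empty using (⊥-elim)
open import Function using (_∘_; case_of_)
open import Relation.Binary.Definitions using (DecidableEquality)
open import Relation.Binary.PropositionalEquality
  using (refl; sym; trans; cong; cong₂; subst; _≢_; module ≡-Reasoning)
open import Relation.Nullary using (Dec; yes; no; does)
open import Relation.Nullary.Decidable using (dec-true)

private variable
  A : Set
  n m k : ℕ

Bool-ext : {a b : Bool} → (a ≡ true → b ≡ true) → (b ≡ true → a ≡ true) → a ≡ b
Bool-ext {false} {false} _   _   = refl
Bool-ext {false} {true}  _   b⇒a = b⇒a refl
Bool-ext {true}  {false} a⇒b _   = sym (a⇒b refl)
Bool-ext {true}  {true}  _   _   = refl

does≡true⇒ : (d : Dec A) → does d ≡ true → A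
does≡true⇒ (yes a) _ = a

-- Vectors and matrices over 𝔽₂

⊕-assoc : (x y z : Vec Bool n) → (x ⊕ y) ⊕ z ≡ x ⊕ (y ⊕ z)
⊕-assoc = zipWith-assoc xor-assoc

⊕-comm : (x y : Vec Bool n) → x ⊕ y ≡ y ⊕ x
⊕-comm = zipWith-comm xor-comm

⊕-identityˡ : (x : Vec Bool n) → 𝟎 ⊕ x ≡ x
⊕-identityˡ = zipWith-identityˡ xor-identityˡ

⊕-identityʳ : (x : Vec Bool n) → x ⊕ 𝟎 ≡ x
⊕-identityʳ = zipWith-identityʳ xor-identityʳ

⊕-self : (x : Vec Bool n) → x ⊕ x ≡ 𝟎
⊕-self []      = refl
⊕-self (a ∷ x) = cong₂ _∷_ (xor-same a) (⊕-self x)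

⊕-cancelʳ : (x y : Vec Bool n) → (x ⊕ y) ⊕ y ≡ x
⊕-cancelʳ x y = begin
  (x ⊕ y) ⊕ y  ≡⟨ ⊕-assoc x y y ⟩
  x ⊕ (y ⊕ y)  ≡⟨ cong (x ⊕_) (⊕-self y) ⟩
  x ⊕ 𝟎        ≡⟨ ⊕-identityʳ x ⟩
  x            ∎
  where open ≡-Reasoning

⊕≡𝟎⇒≡ : (x y : Vec Bool n) → x ⊕ y ≡ 𝟎 → x ≡ y
⊕≡𝟎⇒≡ x y x⊕y≡𝟎 = begin
  x            ≡⟨ sym (⊕-cancelʳ x y) ⟩
  (x ⊕ y) ⊕ y  ≡⟨ cong (_⊕ y) x⊕y≡𝟎 ⟩
  𝟎 ⊕ y        ≡⟨ ⊕-identityˡ y ⟩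
  y            ∎
  where open ≡-Reasoning

⊕-interchange : (w x y z : Vec Bool n) → (w ⊕ x) ⊕ (y ⊕ z) ≡ (w ⊕ y) ⊕ (x ⊕ z)
⊕-interchange w x y z = begin
  (w ⊕ x) ⊕ (y ⊕ z)  ≡⟨ ⊕-assoc w x (y ⊕ z) ⟩
  w ⊕ (x ⊕ (y ⊕ z))  ≡⟨ cong (w ⊕_) (sym (⊕-assoc x y z)) ⟩
  w ⊕ ((x ⊕ y) ⊕ z)  ≡⟨ cong (λ v → w ⊕ (v ⊕ z)) (⊕-comm x y) ⟩
  w ⊕ ((y ⊕ x) ⊕ z)  ≡⟨ cong (w ⊕_) (⊕-assoc y x z) ⟩
  w ⊕ (y ⊕ (x ⊕ z))  ≡⟨ sym (⊕-assoc w y (x ⊕ z)) ⟩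
  (w ⊕ y) ⊕ (x ⊕ z)  ∎
  where open ≡-Reasoning

-- Matrices act on row vectors: c ↦ lincomb c W.
Mat : ℕ → ℕ → Set
Mat k n = Vec (Vec Bool n) k

lincomb-𝟎 : (b : Mat k n) → lincomb 𝟎 b ≡ 𝟎
lincomb-𝟎 []      = refl
lincomb-𝟎 (v ∷ b) = trans (⊕-identityˡ (lincomb 𝟎 b)) (lincomb-𝟎 b)

lincomb-⊕ : (c d : Vec Bool k) (b : Mat k n) → lincomb (c ⊕ d) b ≡ lincomb c b ⊕ lincomb d b
lincomb-⊕ []      []      []      = sym (⊕-self 𝟎)
lincomb-⊕ (a ∷ c) (e ∷ d) (v ∷ b) = begin
  scale (a xor e) ⊕ lincomb (c ⊕ d) b
    ≡⟨ cong₂ _⊕_ (scale-xor a e) (lincomb-⊕ c d b) ⟩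
  (scale a ⊕ scale e) ⊕ (lincomb c b ⊕ lincomb d b)
    ≡⟨ ⊕-interchange (scale a) (scale e) (lincomb c b) (lincomb d b) ⟩
  (scale a ⊕ lincomb c b) ⊕ (scale e ⊕ lincomb d b) ∎
  where
  open ≡-Reasoning
  scale : Bool → Vec Bool _
  scale a = if a then v else 𝟎
  scale-xor : ∀ a e → scale (a xor e) ≡ scale a ⊕ scale e
  scale-xor false e     = sym (⊕-identityˡ (scale e))
  scale-xor true  false = sym (⊕-identityʳ v)
  scale-xor true  true  = sym (⊕-self v)

lincomb-map : (f : Vec Bool n → Vec Bool m) → (∀ x y → f (x ⊕ y) ≡ f x ⊕ f y) → f 𝟎 ≡ 𝟎 →
              (c : Vec Bool k) (b : Mat k n) → f (lincomb c b) ≡ lincomb c (Vec.map f b)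
lincomb-map f f-⊕ f-𝟎 []      []      = f-𝟎
lincomb-map f f-⊕ f-𝟎 (a ∷ c) (v ∷ b) =
  trans (f-⊕ _ (lincomb c b)) (cong₂ _⊕_ (f-scale a) (lincomb-map f f-⊕ f-𝟎 c b))
  where
  f-scale : ∀ a → f (if a then v else 𝟎) ≡ (if a then f v else 𝟎)
  f-scale false = f-𝟎
  f-scale true  = refl

standardBasis : (k : ℕ) → Mat k k
standardBasis zero    = []
standardBasis (suc k) = (true ∷ 𝟎) ∷ Vec.map (false ∷_) (standardBasis k)

lincomb-standardBasis : (c : Vec Bool k) → lincomb c (standardBasis k) ≡ c
lincomb-standardBasis         []      = refl
lincomb-standardBasis {suc k} (a ∷ c) = begin
  e₀ ⊕ lincomb c (Vec.map (false ∷_) (standardBasis k))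
    ≡⟨ cong (e₀ ⊕_) (sym (lincomb-map (false ∷_) (λ _ _ → refl) refl c (standardBasis k))) ⟩
  e₀ ⊕ (false ∷ lincomb c (standardBasis k))
    ≡⟨ cong (λ v → e₀ ⊕ (false ∷ v)) (lincomb-standardBasis c) ⟩
  e₀ ⊕ (false ∷ c)
    ≡⟨ head a ⟩
  a ∷ c ∎
  where
  open ≡-Reasoning
  e₀ : Vec Bool (suc k)
  e₀ = if a then true ∷ 𝟎 else 𝟎
  head : ∀ a → (if a then true ∷ 𝟎 else 𝟎) ⊕ (false ∷ c) ≡ a ∷ c
  head false = cong (false ∷_) (⊕-identityˡ c)
  head true  = cong (true ∷_) (⊕-identityˡ c)

lincomb-injectiveʳ : (b b′ : Mat k n) → (∀ c → lincomb c b ≡ lincomb c b′) → b ≡ b′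
lincomb-injectiveʳ []      []        _     = refl
lincomb-injectiveʳ (v ∷ b) (v′ ∷ b′) b≗b′ = cong₂ _∷_ head (lincomb-injectiveʳ b b′ tail)
  where
  open ≡-Reasoning
  head : v ≡ v′
  head = begin
    v                             ≡⟨ sym (⊕-identityʳ v) ⟩
    v ⊕ 𝟎                         ≡⟨ cong (v ⊕_) (sym (lincomb-𝟎 b)) ⟩
    lincomb (true ∷ 𝟎) (v ∷ b)    ≡⟨ b≗b′ (true ∷ 𝟎) ⟩
    lincomb (true ∷ 𝟎) (v′ ∷ b′)  ≡⟨ cong (v′ ⊕_) (lincomb-𝟎 b′) ⟩
    v′ ⊕ 𝟎                        ≡⟨ ⊕-identityʳ v′ ⟩
    v′                            ∎
  tail : ∀ c → lincomb c b ≡ lincomb c b′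
  tail c = begin
    lincomb c b                    ≡⟨ sym (⊕-identityˡ (lincomb c b)) ⟩
    lincomb (false ∷ c) (v ∷ b)    ≡⟨ b≗b′ (false ∷ c) ⟩
    lincomb (false ∷ c) (v′ ∷ b′)  ≡⟨ ⊕-identityˡ (lincomb c b′) ⟩
    lincomb c b′                   ∎

-- Splitting coordinates along a subset

restrict : (S : Subset n) → Vec A n → Vec A ∣ S ∣
restrict []          []       = []
restrict (true ∷ S)  (x ∷ xs) = x ∷ restrict S xs
restrict (false ∷ S) (x ∷ xs) = restrict S xs

merge : (S : Subset n) → Vec A ∣ S ∣ → Vec A ∣ ∁ S ∣ → Vec A n
merge []          []       []       = []
merge (true ∷ S)  (a ∷ as) ws       = a ∷ merge S as ws
merge (false ∷ S) as       (w ∷ ws) = w ∷ merge S as ws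

merge-restrict : (S : Subset n) (x : Vec A n) → merge S (restrict S x) (restrict (∁ S) x) ≡ x
merge-restrict []          []       = refl
merge-restrict (true ∷ S)  (x ∷ xs) = cong (x ∷_) (merge-restrict S xs)
merge-restrict (false ∷ S) (x ∷ xs) = cong (x ∷_) (merge-restrict S xs)

restrict-merge : (S : Subset n) (a : Vec A ∣ S ∣) (w : Vec A ∣ ∁ S ∣) →
                 restrict S (merge S a w) ≡ a
restrict-merge []          []       []       = refl
restrict-merge (true ∷ S)  (a ∷ as) ws       = cong (a ∷_) (restrict-merge S as ws)
restrict-merge (false ∷ S) as       (w ∷ ws) = restrict-merge S as ws

restrict∁-merge : (S : Subset n) (a : Vec A ∣ S ∣) (w : Vec A ∣ ∁ S ∣) →
                  restrict (∁ S) (merge S a w) ≡ w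
restrict∁-merge []          []       []       = refl
restrict∁-merge (true ∷ S)  (a ∷ as) ws       = restrict∁-merge S as ws
restrict∁-merge (false ∷ S) as       (w ∷ ws) = cong (w ∷_) (restrict∁-merge S as ws)

map-restrict-zipWith-merge : (S : Subset n) (as : Vec (Vec A ∣ S ∣) k) (ws : Vec (Vec A ∣ ∁ S ∣) k) →
                             Vec.map (restrict S) (zipWith (merge S) as ws) ≡ as
map-restrict-zipWith-merge S []       []       = refl
map-restrict-zipWith-merge S (a ∷ as) (w ∷ ws) =
  cong₂ _∷_ (restrict-merge S a w) (map-restrict-zipWith-merge S as ws)

map-restrict∁-zipWith-merge : (S : Subset n) (as : Vec (Vec A ∣ S ∣) k) (ws : Vec (Vec A ∣ ∁ S ∣) k) →
                              Vec.map (restrict (∁ S)) (zipWith (merge S) as ws) ≡ ws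
map-restrict∁-zipWith-merge S []       []       = refl
map-restrict∁-zipWith-merge S (a ∷ as) (w ∷ ws) =
  cong₂ _∷_ (restrict∁-merge S a w) (map-restrict∁-zipWith-merge S as ws)

restrict-⊕ : (S : Subset n) (x y : Vec Bool n) → restrict S (x ⊕ y) ≡ restrict S x ⊕ restrict S y
restrict-⊕ []          []       []       = refl
restrict-⊕ (true ∷ S)  (x ∷ xs) (y ∷ ys) = cong ((x xor y) ∷_) (restrict-⊕ S xs ys)
restrict-⊕ (false ∷ S) (x ∷ xs) (y ∷ ys) = restrict-⊕ S xs ys

restrict-𝟎 : (S : Subset n) → restrict S 𝟎 ≡ 𝟎
restrict-𝟎 []          = refl
restrict-𝟎 (true ∷ S)  = cong (false ∷_) (restrict-𝟎 S)
restrict-𝟎 (false ∷ S) = restrict-𝟎 S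

restrict-lincomb : (S : Subset n) (c : Vec Bool k) (b : Mat k n) →
                   restrict S (lincomb c b) ≡ lincomb c (Vec.map (restrict S) b)
restrict-lincomb S = lincomb-map (restrict S) (restrict-⊕ S) (restrict-𝟎 S)

lincomb-merge : (S : Subset n) (B : Mat ∣ S ∣ n) → Vec.map (restrict S) B ≡ standardBasis ∣ S ∣ →
                (t : Vec Bool ∣ S ∣) → lincomb t B ≡ merge S t (lincomb t (Vec.map (restrict (∁ S)) B))
lincomb-merge S B B↾S≡I t = begin
  lincomb t B
    ≡⟨ sym (merge-restrict S (lincomb t B)) ⟩
  merge S (restrict S (lincomb t B)) (restrict (∁ S) (lincomb t B))
    ≡⟨ cong₂ (merge S) (restrict-lincomb S t B) (restrict-lincomb (∁ S) t B) ⟩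
  merge S (lincomb t (Vec.map (restrict S) B)) w
    ≡⟨ cong (λ I → merge S (lincomb t I) w) B↾S≡I ⟩
  merge S (lincomb t (standardBasis ∣ S ∣)) w
    ≡⟨ cong (λ v → merge S v w) (lincomb-standardBasis t) ⟩
  merge S t w ∎
  where
  open ≡-Reasoning
  w : Vec Bool ∣ ∁ S ∣
  w = lincomb t (Vec.map (restrict (∁ S)) B)

monomial-restrict : (S : Subset n) (x : Vec Bool n) → monomial S x ≡ monomial ⊤ (restrict S x)
monomial-restrict []          []       = refl
monomial-restrict (true ∷ S)  (x ∷ xs) = cong (x ∧_) (monomial-restrict S xs)
monomial-restrict (false ∷ S) (x ∷ xs) = monomial-restrict S xs

monomial-⊤-⊤ : (k : ℕ) → monomial {k} ⊤ ⊤ ≡ true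
monomial-⊤-⊤ zero    = refl
monomial-⊤-⊤ (suc k) = monomial-⊤-⊤ k

monomial-⊤≡true⇒≡⊤ : (x : Vec Bool k) → monomial ⊤ x ≡ true → x ≡ ⊤
monomial-⊤≡true⇒≡⊤ []         _ = refl
monomial-⊤≡true⇒≡⊤ (true ∷ x) e = cong (true ∷_) (monomial-⊤≡true⇒≡⊤ x e)

monomial-translate : (S : Subset n) {z : Vec Bool n} → restrict S z ≡ 𝟎 →
                     (x : Vec Bool n) → monomial S (x ⊕ z) ≡ monomial S x
monomial-translate S {z} z↾S≡𝟎 x = begin
  monomial S (x ⊕ z)                        ≡⟨ monomial-restrict S (x ⊕ z) ⟩
  monomial ⊤ (restrict S (x ⊕ z))           ≡⟨ cong (monomial ⊤) (restrict-⊕ S x z) ⟩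
  monomial ⊤ (restrict S x ⊕ restrict S z)  ≡⟨ cong (λ v → monomial ⊤ (restrict S x ⊕ v)) z↾S≡𝟎 ⟩
  monomial ⊤ (restrict S x ⊕ 𝟎)             ≡⟨ cong (monomial ⊤) (⊕-identityʳ (restrict S x)) ⟩
  monomial ⊤ (restrict S x)                 ≡⟨ sym (monomial-restrict S x) ⟩
  monomial S x                              ∎
  where open ≡-Reasoning

-- Sums over 𝔽₂ⁿ

xorAll : List Bool → Bool
xorAll = List.foldr _xor_ false

xorAll-++ : (as bs : List Bool) → xorAll (as ++ bs) ≡ xorAll as xor xorAll bs
xorAll-++ List.[]       bs = refl
xorAll-++ (a List.∷ as) bs =
  trans (cong (a xor_) (xorAll-++ as bs)) (sym (xor-assoc a (xorAll as) (xorAll bs)))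

-- sumOver U m is definitionally parity n (λ x → (x ∈ᵇ U) ∧ m x).
parity : (n : ℕ) → (Vec Bool n → Bool) → Bool
parity n f = xorAll (map f (allVecs n))

parity-suc : (f : Vec Bool (suc n) → Bool) →
             parity (suc n) f ≡ parity n (f ∘ (false ∷_)) xor parity n (f ∘ (true ∷_))
parity-suc {n} f = begin
  xorAll (map f (map (false ∷_) vs ++ map (true ∷_) vs))
    ≡⟨ cong xorAll (map-++ f (map (false ∷_) vs) (map (true ∷_) vs)) ⟩
  xorAll (map f (map (false ∷_) vs) ++ map f (map (true ∷_) vs))
    ≡⟨ xorAll-++ (map f (map (false ∷_) vs)) (map f (map (true ∷_) vs)) ⟩
  xorAll (map f (map (false ∷_) vs)) xor xorAll (map f (map (true ∷_) vs))
    ≡⟨ cong₂ (λ p q → xorAll p xor xorAll q) (sym (List.map-∘ vs)) (sym (List.map-∘ vs)) ⟩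
  parity n (f ∘ (false ∷_)) xor parity n (f ∘ (true ∷_)) ∎
  where
  open ≡-Reasoning
  vs : List (Vec Bool n)
  vs = allVecs n

parity-cong : (f g : Vec Bool n → Bool) → (∀ x → f x ≡ g x) → parity n f ≡ parity n g
parity-cong {zero}  f g f≗g = cong (_xor false) (f≗g [])
parity-cong {suc n} f g f≗g = begin
  parity (suc n) f
    ≡⟨ parity-suc f ⟩
  parity n (f ∘ (false ∷_)) xor parity n (f ∘ (true ∷_))
    ≡⟨ cong₂ _xor_ (parity-cong _ _ (f≗g ∘ (false ∷_))) (parity-cong _ _ (f≗g ∘ (true ∷_))) ⟩
  parity n (g ∘ (false ∷_)) xor parity n (g ∘ (true ∷_))
    ≡⟨ sym (parity-suc g) ⟩
  parity (suc n) g ∎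
  where open ≡-Reasoning

parity-false : (f : Vec Bool n → Bool) → (∀ x → f x ≡ false) → parity n f ≡ false
parity-false {zero}  f f≡false = cong (_xor false) (f≡false [])
parity-false {suc n} f f≡false = trans (parity-suc f)
  (cong₂ _xor_ (parity-false _ (f≡false ∘ (false ∷_))) (parity-false _ (f≡false ∘ (true ∷_))))

parity-singleton : (f : Vec Bool n → Bool) (v : Vec Bool n) →
                   (∀ x → f x ≡ true → x ≡ v) → f v ≡ true → parity n f ≡ true
parity-singleton {zero}  f []          _      fv = cong (_xor false) fv
parity-singleton {suc n} f (false ∷ v) only-v fv = trans (parity-suc f) (cong₂ _xor_
  (parity-singleton _ v (λ x → proj₂ ∘ ∷-injective ∘ only-v (false ∷ x)) fv)
  (parity-false _ (λ x → off-v (f (true ∷ x)) (proj₁ ∘ ∷-injective ∘ only-v (true ∷ x)))))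
  where
  off-v : ∀ a → (a ≡ true → true ≡ false) → a ≡ false
  off-v false _ = refl
  off-v true  h with () ← h refl
parity-singleton {suc n} f (true ∷ v)  only-v fv = trans (parity-suc f) (cong₂ _xor_
  (parity-false _ (λ x → off-v (f (false ∷ x)) (proj₁ ∘ ∷-injective ∘ only-v (false ∷ x))))
  (parity-singleton _ v (λ x → proj₂ ∘ ∷-injective ∘ only-v (true ∷ x)) fv))
  where
  off-v : ∀ a → (a ≡ true → false ≡ true) → a ≡ false
  off-v false _ = refl
  off-v true  h with () ← h refl

parity-translate : (f : Vec Bool n → Bool) (z : Vec Bool n) → parity n (λ x → f (x ⊕ z)) ≡ parity n f
parity-translate {zero}  f [] = refl
parity-translate {suc n} f (false ∷ z) = begin
  parity (suc n) (λ x → f (x ⊕ (false ∷ z)))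
    ≡⟨ parity-suc (λ x → f (x ⊕ (false ∷ z))) ⟩
  parity n (λ x → f (false ∷ (x ⊕ z))) xor parity n (λ x → f (true ∷ (x ⊕ z)))
    ≡⟨ cong₂ _xor_ (parity-translate (f ∘ (false ∷_)) z) (parity-translate (f ∘ (true ∷_)) z) ⟩
  parity n (f ∘ (false ∷_)) xor parity n (f ∘ (true ∷_))
    ≡⟨ sym (parity-suc f) ⟩
  parity (suc n) f ∎
  where open ≡-Reasoning
parity-translate {suc n} f (true ∷ z) = begin
  parity (suc n) (λ x → f (x ⊕ (true ∷ z)))
    ≡⟨ parity-suc (λ x → f (x ⊕ (true ∷ z))) ⟩
  parity n (λ x → f (true ∷ (x ⊕ z))) xor parity n (λ x → f (false ∷ (x ⊕ z)))
    ≡⟨ cong₂ _xor_ (parity-translate (f ∘ (true ∷_)) z) (parity-translate (f ∘ (false ∷_)) z) ⟩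
  parity n (f ∘ (true ∷_)) xor parity n (f ∘ (false ∷_))
    ≡⟨ xor-comm (parity n (f ∘ (true ∷_))) (parity n (f ∘ (false ∷_))) ⟩
  parity n (f ∘ (false ∷_)) xor parity n (f ∘ (true ∷_))
    ≡⟨ sym (parity-suc f) ⟩
  parity (suc n) f ∎
  where open ≡-Reasoning

-- A nonzero period pairs x with x ⊕ z, so every value is counted twice.
parity-periodic : (f : Vec Bool n → Bool) (z : Vec Bool n) → z ≢ 𝟎 →
                  (∀ x → f (x ⊕ z) ≡ f x) → parity n f ≡ false
parity-periodic {zero}  f []          z≢𝟎 _ with () ← z≢𝟎 refl
parity-periodic {suc n} f (false ∷ z) z≢𝟎 periodic = trans (parity-suc f) (cong₂ _xor_
  (parity-periodic _ z (z≢𝟎 ∘ cong (false ∷_)) (periodic ∘ (false ∷_)))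
  (parity-periodic _ z (z≢𝟎 ∘ cong (false ∷_)) (periodic ∘ (true ∷_))))
parity-periodic {suc n} f (true ∷ z)  _   periodic = begin
  parity (suc n) f
    ≡⟨ parity-suc f ⟩
  parity n (f ∘ (false ∷_)) xor parity n (f ∘ (true ∷_))
    ≡⟨ cong (parity n (f ∘ (false ∷_)) xor_) halves ⟩
  parity n (f ∘ (false ∷_)) xor parity n (f ∘ (false ∷_))
    ≡⟨ xor-same (parity n (f ∘ (false ∷_))) ⟩
  false ∎
  where
  open ≡-Reasoning
  halves : parity n (f ∘ (true ∷_)) ≡ parity n (f ∘ (false ∷_))
  halves = begin
    parity n (f ∘ (true ∷_))             ≡⟨ sym (parity-translate (f ∘ (true ∷_)) z) ⟩
    parity n (λ x → f (true ∷ (x ⊕ z)))  ≡⟨ parity-cong _ _ (periodic ∘ (false ∷_)) ⟩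
    parity n (f ∘ (false ∷_))            ∎

-- Subsets of 𝔽₂ⁿ

_∈ₛ_ : Vec Bool n → BSet n → Set
x ∈ₛ U = x ∈ᵇ U ≡ true

tabulateᴮ : (n : ℕ) → (Vec Bool n → Bool) → BSet n
tabulateᴮ zero    f = f []
tabulateᴮ (suc n) f = tabulateᴮ n (f ∘ (false ∷_)) , tabulateᴮ n (f ∘ (true ∷_))

∈ᵇ-tabulateᴮ : (f : Vec Bool n → Bool) (x : Vec Bool n) → x ∈ᵇ tabulateᴮ n f ≡ f x
∈ᵇ-tabulateᴮ f []          = refl
∈ᵇ-tabulateᴮ f (false ∷ x) = ∈ᵇ-tabulateᴮ (f ∘ (false ∷_)) x
∈ᵇ-tabulateᴮ f (true ∷ x)  = ∈ᵇ-tabulateᴮ (f ∘ (true ∷_)) x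

BSet-ext : (U V : BSet n) → (∀ x → x ∈ₛ U → x ∈ₛ V) → (∀ x → x ∈ₛ V → x ∈ₛ U) → U ≡ V
BSet-ext {zero}  U V U⊆V V⊆U = Bool-ext (U⊆V []) (V⊆U [])
BSet-ext {suc n} (U₀ , U₁) (V₀ , V₁) U⊆V V⊆U = cong₂ _,_
  (BSet-ext U₀ V₀ (U⊆V ∘ (false ∷_)) (V⊆U ∘ (false ∷_)))
  (BSet-ext U₁ V₁ (U⊆V ∘ (true ∷_)) (V⊆U ∘ (true ∷_)))

⊕-Closed : BSet n → Set
⊕-Closed U = ∀ x y → x ∈ₛ U → y ∈ₛ U → (x ⊕ y) ∈ₛ U

span-⊕-closed : {U : BSet n} {b : Mat k n} → IsSpanOf U b → ⊕-Closed U
span-⊕-closed {b = b} spans x y x∈U y∈U with proj₁ (spans x) x∈U | proj₁ (spans y) y∈U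
... | c , refl | d , refl = proj₂ (spans _) (c ⊕ d , lincomb-⊕ c d b)

span-𝟎 : {U : BSet n} {b : Mat k n} → IsSpanOf U b → 𝟎 ∈ₛ U
span-𝟎 {b = b} spans = proj₂ (spans 𝟎) (𝟎 , lincomb-𝟎 b)

lincomb-closed : {U : BSet n} → 𝟎 ∈ₛ U → ⊕-Closed U →
                 {B : Mat k n} → All (_∈ₛ U) B → (c : Vec Bool k) → lincomb c B ∈ₛ U
lincomb-closed         𝟎∈U closed         []          []      = 𝟎∈U
lincomb-closed {U = U} 𝟎∈U closed {v ∷ B} (v∈U ∷ B⊆U) (a ∷ c) =
  closed (if a then v else 𝟎) (lincomb c B) (scaled a) (lincomb-closed 𝟎∈U closed B⊆U c)
  where
  scaled : ∀ a → (if a then v else 𝟎) ∈ₛ U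
  scaled false = 𝟎∈U
  scaled true  = v∈U

∈ᵇ-translate : {U : BSet n} → ⊕-Closed U → {z : Vec Bool n} → z ∈ₛ U →
               (x : Vec Bool n) → (x ⊕ z) ∈ᵇ U ≡ x ∈ᵇ U
∈ᵇ-translate {U = U} closed {z} z∈U x = Bool-ext
  (λ x⊕z∈U → subst (_∈ₛ U) (⊕-cancelʳ x z) (closed (x ⊕ z) z x⊕z∈U z∈U))
  (λ x∈U → closed x z x∈U z∈U)

-- Finite enumerations

IsEnumeration : List A → Set
IsEnumeration xs = Unique xs × (∀ a → a ∈ xs)

unique-⊆⇒length≤ : {xs ys : List A} → Unique xs → (∀ {a} → a ∈ xs → a ∈ ys) → length xs ≤ length ys
unique-⊆⇒length≤ {xs = List.[]}       _               _     = z≤n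
unique-⊆⇒length≤ {xs = x List.∷ xs} (x∉xs ∷ unique) xs⊆ys
  with us , vs , refl ← ∈-∃++ (xs⊆ys (here refl)) =
  subst (suc (length xs) ≤_) (sym (length-++-sucʳ us x vs))
        (s≤s (unique-⊆⇒length≤ unique xs⊆us++vs))
  where
  xs⊆us++vs : ∀ {a} → a ∈ xs → a ∈ us ++ vs
  xs⊆us++vs a∈xs with ∈-++⁻ us (xs⊆ys (there a∈xs))
  ... | inj₁ a∈us         = ∈-++⁺ˡ a∈us
  ... | inj₂ (here refl)  = ⊥-elim (ListAll.lookup x∉xs a∈xs refl)
  ... | inj₂ (there a∈vs) = ∈-++⁺ʳ us a∈vs

injective⇒surjective : DecidableEquality A → {xs : List A} → IsEnumeration xs →
                       (f : A → A) → (∀ {a b} → f a ≡ f b → a ≡ b) → ∀ b → ∃ λ a → f a ≡ b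
injective⇒surjective _≟_ {xs} (unique , complete) f f-injective b with b ∈? map f xs
  where open DecMembership _≟_ using (_∈?_)
... | yes b∈fxs = let a , _ , b≡fa = ∈-map⁻ f b∈fxs in a , sym b≡fa
... | no  b∉fxs =
  ⊥-elim (n≮n (length xs) (subst (λ l → suc l ≤ length xs) (length-map f xs) too-long))
  where
  too-long : length (b List.∷ map f xs) ≤ length xs
  too-long = unique-⊆⇒length≤
    (ListAll.tabulate (λ b′∈fxs b≡b′ → b∉fxs (subst (_∈ map f xs) (sym b≡b′) b′∈fxs))
      ∷ Unique.map⁺ f-injective unique)
    (λ {a} _ → complete a)

HasCard-image : {P : BSet n → Set} {xs : List A} → IsEnumeration xs →
                (g : A → BSet n) → (∀ {a b} → g a ≡ g b → a ≡ b) →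
                (∀ a → P (g a)) → (∀ U → P U → ∃ λ a → U ≡ g a) → HasCard P (length xs)
HasCard-image {P = P} {xs} (unique , complete) g g-injective P-image image-P =
  map g xs , Unique.map⁺ g-injective unique , (λ U → listed⇒P U , P⇒listed U) , length-map g xs
  where
  listed⇒P : ∀ U → U ∈ map g xs → P U
  listed⇒P U U∈gxs = let a , _ , U≡ga = ∈-map⁻ g U∈gxs in subst P (sym U≡ga) (P-image a)
  P⇒listed : ∀ U → P U → U ∈ map g xs
  P⇒listed U PU =
    let a , U≡ga = image-P U PU in subst (_∈ map g xs) (sym U≡ga) (∈-map⁺ g (complete a))

vecsOver : List A → (k : ℕ) → List (Vec A k)
vecsOver xs zero    = [ [] ]
vecsOver xs (suc k) = cartesianProductWith _∷_ xs (vecsOver xs k)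

vecsOver-isEnumeration : {xs : List A} → IsEnumeration xs → IsEnumeration (vecsOver xs k)
vecsOver-isEnumeration {k = zero}  _ = ListAll.[] ∷ [] , λ { [] → here refl }
vecsOver-isEnumeration {k = suc k} {xs} xs-enum@(unique , complete) =
  Unique.cartesianProductWith⁺ _∷_ ∷-injective unique (proj₁ rest) ,
  λ { (a ∷ as) → ∈-cartesianProductWith⁺ _∷_ (complete a) (proj₂ rest as) }
  where
  rest : IsEnumeration (vecsOver xs k)
  rest = vecsOver-isEnumeration xs-enum

length-cartesianProductWith : {B C : Set} (f : A → B → C) (xs : List A) (ys : List B) →
                              length (cartesianProductWith f xs ys) ≡ length xs * length ys
length-cartesianProductWith f List.[]       ys = refl
length-cartesianProductWith f (x List.∷ xs) ys = trans (length-++ (map (f x) ys))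
  (cong₂ _+_ (length-map (f x) ys) (length-cartesianProductWith f xs ys))

length-vecsOver : (xs : List A) (k : ℕ) → length (vecsOver xs k) ≡ length xs ^ k
length-vecsOver xs zero    = refl
length-vecsOver xs (suc k) = trans (length-cartesianProductWith _∷_ xs (vecsOver xs k))
  (cong (length xs *_) (length-vecsOver xs k))

bools : List Bool
bools = false List.∷ true List.∷ List.[]

bools-isEnumeration : IsEnumeration bools
bools-isEnumeration =
  ((λ ()) ListAll.∷ ListAll.[]) ∷ ListAll.[] ∷ [] ,
  λ { false → here refl ; true → there (here refl) }

-- Graphs of linear maps 𝔽₂^S → 𝔽₂^∁S

module _ {n : ℕ} (S : Subset n) where

  graph : Mat ∣ S ∣ ∣ ∁ S ∣ → BSet n
  graph W = tabulateᴮ n λ x →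
    does (Vec.≡-dec Bool._≟_ (restrict (∁ S) x) (lincomb (restrict S x) W))

  ∈-graph⁺ : (W : Mat ∣ S ∣ ∣ ∁ S ∣) (x : Vec Bool n) →
             restrict (∁ S) x ≡ lincomb (restrict S x) W → x ∈ₛ graph W
  ∈-graph⁺ W x eq = trans (∈ᵇ-tabulateᴮ _ x) (dec-true (Vec.≡-dec Bool._≟_ _ _) eq)

  ∈-graph⁻ : (W : Mat ∣ S ∣ ∣ ∁ S ∣) (x : Vec Bool n) →
             x ∈ₛ graph W → restrict (∁ S) x ≡ lincomb (restrict S x) W
  ∈-graph⁻ W x x∈G = does≡true⇒ (Vec.≡-dec Bool._≟_ _ _) (trans (sym (∈ᵇ-tabulateᴮ _ x)) x∈G)

  ∈-graph⇒≡merge : (W : Mat ∣ S ∣ ∣ ∁ S ∣) (x : Vec Bool n) →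
                   x ∈ₛ graph W → x ≡ merge S (restrict S x) (lincomb (restrict S x) W)
  ∈-graph⇒≡merge W x x∈G =
    trans (sym (merge-restrict S x)) (cong (merge S (restrict S x)) (∈-graph⁻ W x x∈G))

  merge-∈-graph : (W : Mat ∣ S ∣ ∣ ∁ S ∣) (t : Vec Bool ∣ S ∣) → merge S t (lincomb t W) ∈ₛ graph W
  merge-∈-graph W t = ∈-graph⁺ W (merge S t (lincomb t W)) (trans
    (restrict∁-merge S t (lincomb t W))
    (cong (λ u → lincomb u W) (sym (restrict-merge S t (lincomb t W)))))

  graphBasis : Mat ∣ S ∣ ∣ ∁ S ∣ → Mat ∣ S ∣ n
  graphBasis W = zipWith (merge S) (standardBasis ∣ S ∣) W

  lincomb-graphBasis : (W : Mat ∣ S ∣ ∣ ∁ S ∣) (t : Vec Bool ∣ S ∣) →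
                       lincomb t (graphBasis W) ≡ merge S t (lincomb t W)
  lincomb-graphBasis W t = trans
    (lincomb-merge S (graphBasis W) (map-restrict-zipWith-merge S (standardBasis ∣ S ∣) W) t)
    (cong (λ V → merge S t (lincomb t V)) (map-restrict∁-zipWith-merge S (standardBasis ∣ S ∣) W))

  graph-isSubspace : (W : Mat ∣ S ∣ ∣ ∁ S ∣) → IsSubspaceOfDim (graph W) ∣ S ∣
  graph-isSubspace W = graphBasis W , independent , spans
    where
    open ≡-Reasoning
    independent : LinearlyIndependent (graphBasis W)
    independent c c·B≡𝟎 = begin
      c                                      ≡⟨ sym (restrict-merge S c (lincomb c W)) ⟩
      restrict S (merge S c (lincomb c W))   ≡⟨ cong (restrict S) (sym (lincomb-graphBasis W c)) ⟩
      restrict S (lincomb c (graphBasis W))  ≡⟨ cong (restrict S) c·B≡𝟎 ⟩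
      restrict S 𝟎                           ≡⟨ restrict-𝟎 S ⟩
      𝟎                                      ∎
    spans : IsSpanOf (graph W) (graphBasis W)
    spans x =
      (λ x∈G → restrict S x ,
               trans (lincomb-graphBasis W (restrict S x)) (sym (∈-graph⇒≡merge W x x∈G))) ,
      λ { (c , refl) → subst (_∈ₛ graph W) (sym (lincomb-graphBasis W c)) (merge-∈-graph W c) }

  -- The monomial is 1 exactly over the all-ones vector ⊤, and a graph has one point there.
  graph-monomialSum : (W : Mat ∣ S ∣ ∣ ∁ S ∣) → sumOver (graph W) (monomial S) ≡ true
  graph-monomialSum W = parity-singleton _ v only-v v-counted
    where
    v : Vec Bool n
    v = merge S ⊤ (lincomb ⊤ W)
    only-v : ∀ x → (x ∈ᵇ graph W) ∧ monomial S x ≡ true → x ≡ v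
    only-v x counted = trans (∈-graph⇒≡merge W x (∧-conicalˡ _ _ counted))
                             (cong (λ t → merge S t (lincomb t W)) x↾S≡⊤)
      where
      x↾S≡⊤ : restrict S x ≡ ⊤
      x↾S≡⊤ = monomial-⊤≡true⇒≡⊤ (restrict S x)
                (trans (sym (monomial-restrict S x)) (∧-conicalʳ _ _ counted))
    v-counted : (v ∈ᵇ graph W) ∧ monomial S v ≡ true
    v-counted = cong₂ _∧_ (merge-∈-graph W ⊤) (begin
      monomial S v               ≡⟨ monomial-restrict S v ⟩
      monomial ⊤ (restrict S v)  ≡⟨ cong (monomial ⊤) (restrict-merge S ⊤ (lincomb ⊤ W)) ⟩
      monomial {∣ S ∣} ⊤ ⊤       ≡⟨ monomial-⊤-⊤ ∣ S ∣ ⟩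
      true                       ∎)
      where open ≡-Reasoning

  graph∈N : (W : Mat ∣ S ∣ ∣ ∁ S ∣) → N n ∣ S ∣ (monomial S) (graph W)
  graph∈N W = graph-isSubspace W , graph-monomialSum W

  graph-injective : {W W′ : Mat ∣ S ∣ ∣ ∁ S ∣} → graph W ≡ graph W′ → W ≡ W′
  graph-injective {W} {W′} G≡G′ = lincomb-injectiveʳ W W′ λ t → begin
    lincomb t W
      ≡⟨ sym (restrict∁-merge S t (lincomb t W)) ⟩
    restrict (∁ S) (merge S t (lincomb t W))
      ≡⟨ ∈-graph⁻ W′ _ (subst (merge S t (lincomb t W) ∈ₛ_) G≡G′ (merge-∈-graph W t)) ⟩
    lincomb (restrict S (merge S t (lincomb t W))) W′
      ≡⟨ cong (λ u → lincomb u W′) (restrict-merge S t (lincomb t W)) ⟩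
    lincomb t W′ ∎
    where open ≡-Reasoning

  RestrictInjectiveOn : BSet n → Set
  RestrictInjectiveOn U = ∀ {x y} → x ∈ₛ U → y ∈ₛ U → restrict S x ≡ restrict S y → x ≡ y

  RestrictSurjectiveOn : BSet n → Set
  RestrictSurjectiveOn U = ∀ t → ∃ λ x → x ∈ₛ U × restrict S x ≡ t

  -- Two points of U over the same S-coordinates differ by a period of the summand.
  monomialSum⇒restrictInjective : {U : BSet n} → ⊕-Closed U → sumOver U (monomial S) ≡ true →
                                  RestrictInjectiveOn U
  monomialSum⇒restrictInjective {U} closed sum≡true {x} {y} x∈U y∈U x↾S≡y↾S
    with Vec.≡-dec Bool._≟_ x y
  ... | yes x≡y = x≡y
  ... | no  x≢y =
    case trans (sym sum≡true) (parity-periodic _ (x ⊕ y) (x≢y ∘ ⊕≡𝟎⇒≡ x y) periodic) of λ ()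
    where
    x⊕y↾S≡𝟎 : restrict S (x ⊕ y) ≡ 𝟎
    x⊕y↾S≡𝟎 = trans (restrict-⊕ S x y)
                    (trans (cong (restrict S x ⊕_) (sym x↾S≡y↾S)) (⊕-self (restrict S x)))
    periodic : ∀ w → ((w ⊕ (x ⊕ y)) ∈ᵇ U) ∧ monomial S (w ⊕ (x ⊕ y)) ≡ (w ∈ᵇ U) ∧ monomial S w
    periodic w = cong₂ _∧_ (∈ᵇ-translate closed (closed x y x∈U y∈U) w)
                           (monomial-translate S x⊕y↾S≡𝟎 w)

  restrictInjective⇒restrictSurjective : {U : BSet n} {b : Mat ∣ S ∣ n} →
    IsSpanOf U b → LinearlyIndependent b → RestrictInjectiveOn U → RestrictSurjectiveOn U
  restrictInjective⇒restrictSurjective {U} {b} spans independent injective t =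
    let c , Fc≡t = injective⇒surjective (Vec.≡-dec Bool._≟_)
                     (vecsOver-isEnumeration bools-isEnumeration) F F-injective t
    in lincomb c b , ∈U c , Fc≡t
    where
    F : Vec Bool ∣ S ∣ → Vec Bool ∣ S ∣
    F c = restrict S (lincomb c b)
    ∈U : ∀ c → lincomb c b ∈ₛ U
    ∈U c = proj₂ (spans (lincomb c b)) (c , refl)
    F-injective : ∀ {c d} → F c ≡ F d → c ≡ d
    F-injective {c} {d} Fc≡Fd = ⊕≡𝟎⇒≡ c d (independent (c ⊕ d) (begin
      lincomb (c ⊕ d) b          ≡⟨ lincomb-⊕ c d b ⟩
      lincomb c b ⊕ lincomb d b  ≡⟨ cong (lincomb c b ⊕_) (sym (injective (∈U c) (∈U d) Fc≡Fd)) ⟩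
      lincomb c b ⊕ lincomb c b  ≡⟨ ⊕-self (lincomb c b) ⟩
      𝟎                          ∎))
      where open ≡-Reasoning

  graph⊆⇒≡graph : {U : BSet n} (W : Mat ∣ S ∣ ∣ ∁ S ∣) →
           (∀ t → merge S t (lincomb t W) ∈ₛ U) → RestrictInjectiveOn U → U ≡ graph W
  graph⊆⇒≡graph {U} W graph⊆U injective = BSet-ext U (graph W) U⊆graph
    (λ x x∈G → subst (_∈ₛ U) (sym (∈-graph⇒≡merge W x x∈G)) (graph⊆U (restrict S x)))
    where
    U⊆graph : ∀ x → x ∈ₛ U → x ∈ₛ graph W
    U⊆graph x x∈U = ∈-graph⁺ W x (begin
      restrict (∁ S) x  ≡⟨ cong (restrict (∁ S)) x≡y ⟩
      restrict (∁ S) y  ≡⟨ restrict∁-merge S (restrict S x) (lincomb (restrict S x) W) ⟩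
      lincomb (restrict S x) W ∎)
      where
      open ≡-Reasoning
      y : Vec Bool n
      y = merge S (restrict S x) (lincomb (restrict S x) W)
      x≡y : x ≡ y
      x≡y = injective x∈U (graph⊆U (restrict S x)) (sym (restrict-merge S (restrict S x) _))

  -- The rows of W are the ∁S-coordinates of the points of U over the unit vectors.
  bijectiveRestrict⇒graph : {U : BSet n} → 𝟎 ∈ₛ U → ⊕-Closed U →
                            RestrictInjectiveOn U → RestrictSurjectiveOn U → ∃ λ W → U ≡ graph W
  bijectiveRestrict⇒graph {U} 𝟎∈U closed injective surjective =
    W , graph⊆⇒≡graph W graph⊆U injective
    where
    B : Mat ∣ S ∣ n
    B = Vec.map (proj₁ ∘ surjective) (standardBasis ∣ S ∣)
    W : Mat ∣ S ∣ ∣ ∁ S ∣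
    W = Vec.map (restrict (∁ S)) B
    B⊆U : All (_∈ₛ U) B
    B⊆U = All.map⁺ (All.universal (proj₁ ∘ proj₂ ∘ surjective) _)
    B↾S≡I : Vec.map (restrict S) B ≡ standardBasis ∣ S ∣
    B↾S≡I = trans (sym (map-∘ (restrict S) (proj₁ ∘ surjective) _))
                  (trans (map-cong (proj₂ ∘ proj₂ ∘ surjective) _) (map-id _))
    graph⊆U : ∀ t → merge S t (lincomb t W) ∈ₛ U
    graph⊆U t = subst (_∈ₛ U) (lincomb-merge S B B↾S≡I t) (lincomb-closed 𝟎∈U closed B⊆U t)

  N⇒graph : (U : BSet n) → N n ∣ S ∣ (monomial S) U → ∃ λ W → U ≡ graph W
  N⇒graph U ((b , independent , spans) , sum≡true) =
    bijectiveRestrict⇒graph (span-𝟎 spans) closed injective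
      (restrictInjective⇒restrictSurjective spans independent injective)
    where
    closed : ⊕-Closed U
    closed = span-⊕-closed spans
    injective : RestrictInjectiveOn U
    injective = monomialSum⇒restrictInjective closed sum≡true

corollary5p2 : (n k : ℕ) (S : Subset n) → ∣ S ∣ ≡ k →
    HasCard (N n k (monomial S)) (2 ^ (k * (n ∸ k)))
corollary5p2 n .(∣ S ∣) S refl =
  subst (HasCard (N n ∣ S ∣ (monomial S))) count
    (HasCard-image (vecsOver-isEnumeration (vecsOver-isEnumeration bools-isEnumeration))
                   (graph S) (graph-injective S) (graph∈N S) (N⇒graph S))
  where
  open ≡-Reasoning
  count : length (vecsOver (vecsOver bools ∣ ∁ S ∣) ∣ S ∣) ≡ 2 ^ (∣ S ∣ * (n ∸ ∣ S ∣))
  count = begin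
    length (vecsOver (vecsOver bools ∣ ∁ S ∣) ∣ S ∣)
      ≡⟨ length-vecsOver (vecsOver bools ∣ ∁ S ∣) ∣ S ∣ ⟩
    length (vecsOver bools ∣ ∁ S ∣) ^ ∣ S ∣
      ≡⟨ cong (_^ ∣ S ∣) (length-vecsOver bools ∣ ∁ S ∣) ⟩
    (2 ^ ∣ ∁ S ∣) ^ ∣ S ∣
      ≡⟨ ^-*-assoc 2 ∣ ∁ S ∣ ∣ S ∣ ⟩
    2 ^ (∣ ∁ S ∣ * ∣ S ∣)
      ≡⟨ cong (2 ^_) (*-comm ∣ ∁ S ∣ ∣ S ∣) ⟩
    2 ^ (∣ S ∣ * ∣ ∁ S ∣)
      ≡⟨ cong (λ j → 2 ^ (∣ S ∣ * j)) (∣∁p∣≡n∸∣p∣ S) ⟩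
    2 ^ (∣ S ∣ * (n ∸ ∣ S ∣)) ∎
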